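{- Let $G$ be a bridgeless cubic graph and let $F$ be a $2$-factor of $G$ such that $G/F$ is $5$-odd-edge-connected. Then every $5$-circuit of $F$ belongs to $\mathcal{C}^I_G$ or to $\mathcal{C}^N_G$.
   Context: A circuit is a connected $2$-regular subgraph; a $5$-circuit has $5$ edges. A $2$-factor $F$ of $G$ is a spanning $2$-regular subgraph; its components are circuits, called the circuits of $F$. $G/F$ denotes the graph obtained from $G$ by contracting all edges of $F$. A graph $H$ is $5$-odd-edge-connected if $|\partial_H(A)|\notin\{1,3\}$ for every $A\subseteq V(H)$, where $\partial_H(A)$ is the set of edges with exactly one end in $A$. Two circuits intersect if they share at least one edge. $\mathcal{C}^I_G$ is the set of $5$-circuits of $G$ that intersect some other $5$-circuit of $G$ in exactly one edge or in exactly two adjacent edges; $\mathcal{C}^N_G$ is the set of $5$-circuits of $G$ that intersect no other $5$-circuit of $G$. -}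

module Defs where

open import Data.Nat using (ℕ; zero; suc; _+_; _<_)
open import Data.Bool using (Bool; true; false; if_then_else_; not; _∧_; _xor_)
open import Data.Fin using (Fin; _≟_)
open import Data.List using (List; map; allFin)
open import Data.Nat.ListAction using (sum)
open import Data.Product using (_×_; _,_; proj₁; proj₂; Σ; ∃)
open import Data.Sum using (_⊎_)
open import Relation.Nullary using (¬_; does)
open import Relation.Binary.PropositionalEquality using (_≡_; _≢_)

-- A (multi)graph with vertex set Fin n and edge set Fin m;
-- each edge is given by its (unordered) pair of ends.
Graph : ℕ → ℕ → Set
Graph n m = Fin m → Fin n × Fin n

-- A set of edges (a subgraph without isolated vertices), as a Boolean predicate.
EdgeSet : ℕ → Set
EdgeSet m = Fin m → Bool

VertexSet : ℕ → Set
VertexSet n = Fin n → Bool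

allEdges : ∀ {m} → EdgeSet m
allEdges _ = true

count : ∀ {k} → (Fin k → Bool) → ℕ
count {k} p = sum (map (λ i → if p i then 1 else 0) (allFin k))

-- number of ends of edge e at vertex v (a loop counts twice)
endsAt : ∀ {n m} → Graph n m → Fin n → Fin m → ℕ
endsAt G v e =
  (if does (proj₁ (G e) ≟ v) then 1 else 0) + (if does (proj₂ (G e) ≟ v) then 1 else 0)

deg : ∀ {n m} → Graph n m → EdgeSet m → Fin n → ℕ
deg {m = m} G S v = sum (map (λ e → if S e then endsAt G v e else 0) (allFin m))

data Reach {n m} (G : Graph n m) (S : EdgeSet m) : Fin n → Fin n → Set where
  here : ∀ {v} → Reach G S v v
  step : ∀ {u w v} (e : Fin m) → S e ≡ true →
         ((proj₁ (G e) ≡ u × proj₂ (G e) ≡ w) ⊎ (proj₁ (G e) ≡ w × proj₂ (G e) ≡ u)) →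
         Reach G S w v → Reach G S u v

IsCircuit : ∀ {n m} → Graph n m → EdgeSet m → Set
IsCircuit {n} {m} G C =
  (∃ λ (e : Fin m) → C e ≡ true)
  × (∀ v → deg G C v ≡ 0 ⊎ deg G C v ≡ 2)
  × (∀ u v → 0 < deg G C u → 0 < deg G C v → Reach G C u v)

size : ∀ {m} → EdgeSet m → ℕ
size = count

_⊆E_ : ∀ {m} → EdgeSet m → EdgeSet m → Set
S ⊆E T = ∀ e → S e ≡ true → T e ≡ true

Cubic : ∀ {n m} → Graph n m → Set
Cubic G = ∀ v → deg G allEdges v ≡ 3

Bridgeless : ∀ {n m} → Graph n m → Set
Bridgeless G = ∀ e → Reach G (λ f → not (does (f ≟ e))) (proj₁ (G e)) (proj₂ (G e))

IsTwoFactor : ∀ {n m} → Graph n m → EdgeSet m → Set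
IsTwoFactor G F = ∀ v → deg G F v ≡ 2

-- C is a circuit of F, i.e. a component of F: a circuit contained in F
-- such that no further edge of F touches a vertex of C
CircuitOf : ∀ {n m} → Graph n m → EdgeSet m → EdgeSet m → Set
CircuitOf G F C =
  IsCircuit G C × C ⊆E F
  × (∀ e → F e ≡ true → C e ≡ false → ∀ v → 0 < endsAt G v e → deg G C v ≡ 0)

-- Vertices of G/F are the circuits of F; a set A of vertices
-- of G/F is represented by the union X ⊆ V(G) of the circuits in A, i.e. by a
-- vertex set X closed under F-edges. Edges of G/F are the edges of G not in F,
-- with ends the circuits of F containing their ends.
FClosed : ∀ {n m} → Graph n m → EdgeSet m → VertexSet n → Set
FClosed G F X = ∀ e → F e ≡ true → X (proj₁ (G e)) ≡ X (proj₂ (G e))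

cutContr : ∀ {n m} → Graph n m → EdgeSet m → VertexSet n → ℕ
cutContr G F X = count (λ e → not (F e) ∧ (X (proj₁ (G e)) xor X (proj₂ (G e))))

ContractionFiveOddEdgeConnected : ∀ {n m} → Graph n m → EdgeSet m → Set
ContractionFiveOddEdgeConnected G F =
  ∀ X → FClosed G F X → cutContr G F X ≢ 1 × cutContr G F X ≢ 3

FiveCircuit : ∀ {n m} → Graph n m → EdgeSet m → Set
FiveCircuit G C = IsCircuit G C × size C ≡ 5

Different : ∀ {m} → EdgeSet m → EdgeSet m → Set
Different C D = ¬ (∀ e → C e ≡ D e)

_∩E_ : ∀ {m} → EdgeSet m → EdgeSet m → EdgeSet m
(C ∩E D) e = C e ∧ D e

TwoAdjacent : ∀ {n m} → Graph n m → EdgeSet m → Set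
TwoAdjacent G S =
  size S ≡ 2 × (∃ λ e → ∃ λ f → e ≢ f × S e ≡ true × S f ≡ true
                 × ∃ λ v → 0 < endsAt G v e × 0 < endsAt G v f)

InCI : ∀ {n m} → Graph n m → EdgeSet m → Set
InCI G C = FiveCircuit G C ×
  ∃ λ D → FiveCircuit G D × Different C D × (size (C ∩E D) ≡ 1 ⊎ TwoAdjacent G (C ∩E D))

InCN : ∀ {n m} → Graph n m → EdgeSet m → Set
InCN G C = FiveCircuit G C ×
  (∀ D → FiveCircuit G D → Different C D → ∀ e → (C ∩E D) e ≡ false)

module Submission where

-- Let V be the vertex set of the 5-circuit C of F. Every vertex meets exactly one edge outside F,
-- so counting these edges at V gives |V| = 2·(chords of V) + |∂_{G/F}(V)|; as V is a vertex of G/F,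
-- 5-odd-edge-connectivity forces |∂_{G/F}(V)| = 5, and V spans no chord. Now let D ≠ C be another
-- 5-circuit meeting C, with I = C ∩ D and O = D − C. An edge of O at a vertex of C is the unique
-- non-F edge there, so it has at most one end in V; counting ends at V gives 2|I| = b + 2s, where
-- b ≤ |O| = 5 − |I| counts ends in V of O-edges and s counts vertices of C whose two C-edges lie in D.
-- Connectivity of C gives b ≥ 1 (otherwise D ⊇ C), and parity leaves |I| = 1, or |I| = 2 with s ≥ 1
-- (two adjacent edges), or every O-edge leaving V exactly once; the last is impossible, because the
-- outer end of such an edge would carry two O-edges, none of them in F.
-- Constructively, the choice between 𝒞^I and 𝒞^N is made by exhaustive search over all edge sets,
-- reachability being decided by saturating the set of vertices that reach a given vertex.

open import Defs
open import Data.Nat using (ℕ)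
open import Data.Sum using (_⊎_)
open import Relation.Binary.PropositionalEquality using (_≡_)

open import Data.Bool using (Bool; true; false; if_then_else_; not; _∧_; _∨_; _xor_)
import Data.Bool.Properties as Bool
open import Data.Bool.Properties using (∧-comm; ∧-conicalˡ; ∧-conicalʳ)
open import Data.Empty using (⊥; ⊥-elim)
open import Data.Fin using (Fin; zero; suc; _≟_)
import Data.Fin.Properties as Fin
open import Data.Fin.Subset.Properties using (anySubset?)
import Data.List as List
import Data.List.Properties as List
open import Data.Nat using (zero; suc; _+_; _*_; _≤_; _<_; z≤n; s≤s; _≤?_)
open import Data.Nat.GeneralisedArithmetic using (fold)
import Data.Nat.ListAction as ListAction
import Data.Nat.Properties as ℕ
open import Algebra.Properties.Semiring.Sum ℕ.+-*-semiring
  using (sum; ∑-distrib-+; ∑-comm; sum-cong-≗; sum-replicate-zero; *-distribˡ-sum)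
open import Data.Nat.Properties
  using (≤-refl; ≤-trans; ≤-reflexive; ≤-antisym; <⇒≱; ≮⇒≥; n≤0⇒n≡0; n<1+n; m≤m+n; m≤n+m;
         +-comm; +-identityʳ; +-cancelˡ-≡; +-cancelˡ-≤; +-cancelʳ-≤; +-mono-≤; +-monoʳ-≤; +-mono-<-≤; +-mono-≤-<;
         *-cancelˡ-≡; *-monoʳ-≤; 0≢1+n; even≢odd)
open import Data.Product using (_×_; _,_; proj₁; proj₂; ∃)
import Data.Sum
open import Data.Sum using (inj₁; inj₂)
import Data.Vec as Vec
import Data.Vec.Properties as Vec
open import Function using (_∘_; case_of_)
open import Function.Bundles using (mk⇔)
open import Relation.Binary.PropositionalEquality
  using (_≢_; _≗_; refl; sym; trans; cong; cong₂; subst; module ≡-Reasoning)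
open import Relation.Nullary using (¬_; Dec; does; yes; no)
open import Relation.Nullary.Decidable
  using (map′; dec-true; dec-false; does-⇔; ¬?; _×-dec_; _⊎-dec_; _→-dec_)

-- Finite sums over Fin k

𝟙 : Bool → ℕ
𝟙 b = if b then 1 else 0

∣_∣ : ∀ {k} → (Fin k → Bool) → ℕ
∣ X ∣ = sum (𝟙 ∘ X)

sumOver : ∀ {k} → (Fin k → Bool) → (Fin k → ℕ) → ℕ
sumOver X f = sum (λ i → if X i then f i else 0)

private variable
  k l : ℕ
  i j : Fin k
  f g : Fin k → ℕ
  p q : Fin k → Bool

dec-true⁻¹ : ∀ {a} {A : Set a} (a? : Dec A) → does a? ≡ true → A
dec-true⁻¹ (yes a) _ = a

dec-false⁻¹ : ∀ {a} {A : Set a} (a? : Dec A) → does a? ≡ false → ¬ A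
dec-false⁻¹ (no ¬a) _ = ¬a

sum-allFin : (f : Fin k → ℕ) → ListAction.sum (List.map f (List.allFin k)) ≡ sum f
sum-allFin f = trans (cong ListAction.sum (List.map-tabulate (λ i → i) f)) (sum-tabulate f)
  where
  sum-tabulate : (g : Fin k → ℕ) → ListAction.sum (List.tabulate g) ≡ sum g
  sum-tabulate {zero} g = refl
  sum-tabulate {suc k} g = cong (g zero +_) (sum-tabulate (g ∘ suc))

count≡∣∣ : (X : Fin k → Bool) → count X ≡ ∣ X ∣
count≡∣∣ X = sum-allFin (𝟙 ∘ X)

sum-mono-≤ : (∀ i → f i ≤ g i) → sum f ≤ sum g
sum-mono-≤ {zero} _ = z≤n
sum-mono-≤ {suc k} f≤g = +-mono-≤ (f≤g zero) (sum-mono-≤ (f≤g ∘ suc))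

sum-mono-< : (∀ i → f i ≤ g i) → f i < g i → sum f < sum g
sum-mono-< {i = zero} f≤g fi<gi = +-mono-<-≤ fi<gi (sum-mono-≤ (f≤g ∘ suc))
sum-mono-< {i = suc i} f≤g fi<gi = +-mono-≤-< (f≤g zero) (sum-mono-< (f≤g ∘ suc) fi<gi)

term≤sum : (f : Fin k → ℕ) (i : Fin k) → f i ≤ sum f
term≤sum f zero = m≤m+n _ _
term≤sum f (suc i) = ≤-trans (term≤sum (f ∘ suc) i) (m≤n+m _ _)

two-terms≤sum : (f : Fin k → ℕ) → i ≢ j → f i + f j ≤ sum f
two-terms≤sum {i = zero} {zero} f i≢j = ⊥-elim (i≢j refl)
two-terms≤sum {i = zero} {suc j} f _ = +-monoʳ-≤ (f zero) (term≤sum (f ∘ suc) j)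
two-terms≤sum {i = suc i} {zero} f _ =
  subst (_≤ sum f) (+-comm (f zero) (f (suc i))) (+-monoʳ-≤ (f zero) (term≤sum (f ∘ suc) i))
two-terms≤sum {i = suc i} {suc j} f i≢j =
  ≤-trans (two-terms≤sum (f ∘ suc) (i≢j ∘ cong suc)) (m≤n+m _ _)

sum-positive : (f : Fin k → ℕ) → 0 < sum f → ∃ λ i → 0 < f i
sum-positive {suc k} f 0<∑f with f zero in f₀≡
... | suc _ = zero , subst (0 <_) (sym f₀≡) (s≤s z≤n)
... | zero with sum-positive (f ∘ suc) 0<∑f
...   | i , 0<fi = suc i , 0<fi

pointwise-≤-sum-≡ : (∀ i → f i ≤ g i) → sum f ≡ sum g → f ≗ g
pointwise-≤-sum-≡ {suc k} {f} {g} f≤g ∑f≡∑g zero =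
  ≤-antisym (f≤g zero) (+-cancelʳ-≤ _ _ _
    (≤-trans (≤-reflexive (sym ∑f≡∑g)) (+-monoʳ-≤ (f zero) (sum-mono-≤ (f≤g ∘ suc)))))
pointwise-≤-sum-≡ {suc k} {f} {g} f≤g ∑f≡∑g (suc i) =
  pointwise-≤-sum-≡ (f≤g ∘ suc)
    (+-cancelˡ-≡ (f zero) _ _
      (trans ∑f≡∑g (cong (_+ sum (g ∘ suc)) (sym (pointwise-≤-sum-≡ f≤g ∑f≡∑g zero))))) i

two-unit-terms : (f : Fin k → ℕ) → (∀ i → f i ≤ 1) → 2 ≤ sum f →
                 ∃ λ i → ∃ λ j → i ≢ j × f i ≡ 1 × f j ≡ 1
two-unit-terms {suc k} f f≤1 2≤∑f with f zero in f₀≡ | f≤1 zero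
... | zero | _ with two-unit-terms (f ∘ suc) (f≤1 ∘ suc) 2≤∑f
...   | i , j , i≢j , fi≡1 , fj≡1 = suc i , suc j , i≢j ∘ Fin.suc-injective , fi≡1 , fj≡1
two-unit-terms {suc k} f f≤1 (s≤s 1≤∑f) | suc zero | _ with sum-positive (f ∘ suc) 1≤∑f
... | j , 0<fj = zero , suc j , (λ ()) , f₀≡ , ≤-antisym (f≤1 (suc j)) 0<fj
two-unit-terms {suc k} f f≤1 2≤∑f | suc (suc _) | s≤s ()

sum-singleton : (i : Fin k) (f : Fin k → ℕ) → sumOver (λ j → does (i ≟ j)) f ≡ f i
sum-singleton {suc k} zero f = trans (cong (f zero +_) (sum-replicate-zero k)) (+-identityʳ _)
sum-singleton {suc k} (suc i) f = sum-singleton i (f ∘ suc)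

𝟙-injective : ∀ {a b} → 𝟙 a ≡ 𝟙 b → a ≡ b
𝟙-injective {true} {true} _ = refl
𝟙-injective {false} {false} _ = refl

𝟙-positive : ∀ {b} → 0 < 𝟙 b → b ≡ true
𝟙-positive {true} _ = refl

𝟙-mono : ∀ {a b} → (a ≡ true → b ≡ true) → 𝟙 a ≤ 𝟙 b
𝟙-mono {true} a⇒b rewrite a⇒b refl = ≤-refl
𝟙-mono {false} _ = z≤n

if-then-0-≤ : ∀ b {x y} → x ≤ y → (if b then x else 0) ≤ y
if-then-0-≤ true x≤y = x≤y
if-then-0-≤ false _ = z≤n

if-then-0-≡1 : ∀ {b x} → (if b then x else 0) ≡ 1 → b ≡ true × 0 < x
if-then-0-≡1 {true} refl = refl , s≤s z≤n

⊆-∣∣-≡⇒≗ : p ⊆E q → ∣ p ∣ ≡ ∣ q ∣ → p ≗ q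
⊆-∣∣-≡⇒≗ p⊆q ∣p∣≡∣q∣ i = 𝟙-injective (pointwise-≤-sum-≡ (λ j → 𝟙-mono (p⊆q j)) ∣p∣≡∣q∣ i)

∣∣≡0⇒empty : ∣ p ∣ ≡ 0 → ∀ i → p i ≡ false
∣∣≡0⇒empty {k} {p} ∣p∣≡0 i =
  𝟙-injective (sym (pointwise-≤-sum-≡ {f = λ _ → 0} (λ _ → z≤n) (trans (sum-replicate-zero k) (sym ∣p∣≡0)) i))

_∖E_ : ∀ {m} → EdgeSet m → EdgeSet m → EdgeSet m
(S ∖E T) e = S e ∧ not (T e)

∖E⇒∉ : ∀ {m} {S T : EdgeSet m} {e} → (S ∖E T) e ≡ true → T e ≡ false
∖E⇒∉ {S = S} {T} {e} = not-in (S e) (T e)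
  where
  not-in : ∀ a b → a ∧ not b ≡ true → b ≡ false
  not-in true false _ = refl

if-sum : (b : Bool) (f : Fin k → ℕ) → (if b then sum f else 0) ≡ sum (λ i → if b then f i else 0)
if-sum true f = refl
if-sum {k} false f = sym (sum-replicate-zero k)

sumOver-comm : (X : Fin k → Bool) (Y : Fin l → Bool) (h : Fin k → Fin l → ℕ) →
               sumOver X (λ i → sumOver Y (h i)) ≡ sumOver Y (λ j → sumOver X (λ i → h i j))
sumOver-comm {k} {l} X Y h = begin
  sum (λ i → if X i then sum (λ j → if Y j then h i j else 0) else 0)
    ≡⟨ sum-cong-≗ {k} (λ i → if-sum (X i) (λ j → if Y j then h i j else 0)) ⟩
  sum (λ i → sum (λ j → if X i then (if Y j then h i j else 0) else 0))
    ≡⟨ ∑-comm (λ i j → if X i then (if Y j then h i j else 0) else 0) ⟩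
  sum (λ j → sum (λ i → if X i then (if Y j then h i j else 0) else 0))
    ≡⟨ sum-cong-≗ {l} (λ j → trans (sum-cong-≗ {k} (λ i → if-swap (X i) (Y j)))
                                    (sym (if-sum (Y j) (λ i → if X i then h i j else 0)))) ⟩
  sum (λ j → if Y j then sum (λ i → if X i then h i j else 0) else 0) ∎
  where
  open ≡-Reasoning
  if-swap : ∀ a b {x} → (if a then (if b then x else 0) else 0) ≡ (if b then (if a then x else 0) else 0)
  if-swap true true = refl
  if-swap true false = refl
  if-swap false true = refl
  if-swap false false = refl

sumOver-split : (X Y : Fin k → Bool) (f : Fin k → ℕ) → sumOver X f ≡ sumOver (X ∩E Y) f + sumOver (X ∖E Y) f
sumOver-split X Y f = trans (sum-cong-≗ split) (∑-distrib-+ (λ i → if X i ∧ Y i then f i else 0) _)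
  where
  split : ∀ i → (if X i then f i else 0) ≡ (if X i ∧ Y i then f i else 0) + (if X i ∧ not (Y i) then f i else 0)
  split i with X i | Y i
  ... | true | true = sym (+-identityʳ _)
  ... | true | false = refl
  ... | false | _ = refl

sumOver-mono : p ⊆E q → (f : Fin k → ℕ) → sumOver p f ≤ sumOver q f
sumOver-mono {p = X} {Y} X⊆Y f = sum-mono-≤ pointwise
  where
  pointwise : ∀ i → (if X i then f i else 0) ≤ (if Y i then f i else 0)
  pointwise i with X i in Xi
  ... | true rewrite X⊆Y i Xi = ≤-refl
  ... | false = z≤n

term≤sumOver : p i ≡ true → (f : Fin k → ℕ) → f i ≤ sumOver p f
term≤sumOver {p = X} {i} Xi f =
  subst (_≤ sumOver X f) (cong (if_then f i else 0) Xi) (term≤sum (λ j → if X j then f j else 0) i)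

sumOver-cong : p ≗ q → (f : Fin k → ℕ) → sumOver p f ≡ sumOver q f
sumOver-cong p≗q f = sum-cong-≗ (λ i → cong (if_then f i else 0) (p≗q i))

sum-double : (f : Fin k → ℕ) → sum (λ i → 2 * f i) ≡ 2 * sum f
sum-double f = sym (*-distribˡ-sum 2 f)

∨-true : ∀ a b → a ∨ b ≡ true → a ≡ true ⊎ b ≡ true
∨-true true _ _ = inj₁ refl
∨-true false _ b≡true = inj₂ b≡true

∣p∣≤k : ∀ {k} (p : Fin k → Bool) → ∣ p ∣ ≤ k
∣p∣≤k {k} p = ≤-trans (sum-mono-≤ (λ i → 𝟙≤1 (p i))) (≤-reflexive (sum-ones k))
  where
  𝟙≤1 : ∀ b → 𝟙 b ≤ 1
  𝟙≤1 true = ≤-refl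
  𝟙≤1 false = z≤n
  sum-ones : ∀ l → sum {l} (λ _ → 1) ≡ l
  sum-ones zero = refl
  sum-ones (suc l) = cong suc (sum-ones l)

2*k+c≡1⇒c≡1 : ∀ k c → 2 * k + c ≡ 1 → c ≡ 1
2*k+c≡1⇒c≡1 zero c eq = eq
2*k+c≡1⇒c≡1 (suc k) c eq =
  ⊥-elim (<⇒≱ (n<1+n 1) (≤-trans (*-monoʳ-≤ 2 (m≤m+n 1 k)) (≤-trans (m≤m+n _ c) (≤-reflexive eq))))

2*k+c≡5⇒k≡0 : ∀ k c → 2 * k + c ≡ 5 → c ≢ 1 → c ≢ 3 → k ≡ 0
2*k+c≡5⇒k≡0 0 c eq c≢1 c≢3 = refl
2*k+c≡5⇒k≡0 1 c eq c≢1 c≢3 = ⊥-elim (c≢3 (+-cancelˡ-≡ 2 c 3 eq))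
2*k+c≡5⇒k≡0 2 c eq c≢1 c≢3 = ⊥-elim (c≢1 (+-cancelˡ-≡ 4 c 1 eq))
2*k+c≡5⇒k≡0 (suc (suc (suc k))) c eq _ _ =
  ⊥-elim (<⇒≱ (n<1+n 5) (≤-trans (*-monoʳ-≤ 2 (m≤m+n 3 k)) (≤-trans (m≤m+n _ c) (≤-reflexive eq))))

even-split : ∀ a b → a ≤ 2 → b ≤ 1 → a + b ≡ 0 ⊎ a + b ≡ 2 → a ≡ b + 2 * 𝟙 (does (a ℕ.≟ 2))
even-split 0 0 _ _ _ = refl
even-split 1 1 _ _ _ = refl
even-split 2 0 _ _ _ = refl
even-split 0 1 _ _ (inj₁ ())
even-split 0 1 _ _ (inj₂ ())
even-split 1 0 _ _ (inj₁ ())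
even-split 1 0 _ _ (inj₂ ())
even-split 2 1 _ _ (inj₁ ())
even-split 2 1 _ _ (inj₂ ())
even-split (suc (suc (suc _))) _ (s≤s (s≤s ())) _ _
even-split _ (suc (suc _)) _ (s≤s ()) _

intersection-arith : ∀ i o b s → 2 * i ≡ b + 2 * s → b ≤ o → i + o ≡ 5 → 0 < b →
                     i ≡ 1 ⊎ (i ≡ 2 × 0 < s) ⊎ (b ≡ o × 0 < o)
intersection-arith 0 _ (suc _) _ () _ _ _
intersection-arith 1 _ _ _ _ _ _ _ = inj₁ refl
intersection-arith 2 .3 b zero eq b≤3 refl _ =
  ⊥-elim (<⇒≱ (n<1+n 3) (subst (_≤ 3) (trans (sym (+-identityʳ b)) (sym eq)) b≤3))
intersection-arith 2 .3 _ (suc _) _ _ refl _ = inj₂ (inj₁ (refl , s≤s z≤n))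
intersection-arith 3 .2 1 s eq _ refl _ = ⊥-elim (even≢odd 3 s eq)
intersection-arith 3 .2 2 _ _ _ refl _ = inj₂ (inj₂ (refl , s≤s z≤n))
intersection-arith 3 .2 (suc (suc (suc _))) _ _ (s≤s (s≤s ())) refl _
intersection-arith 4 .1 1 s eq _ refl _ = ⊥-elim (even≢odd 4 s eq)
intersection-arith 4 .1 (suc (suc _)) _ _ (s≤s ()) refl _
intersection-arith 5 .0 (suc _) _ _ () refl _

-- Degrees and double counting

module Degrees {n m : ℕ} (G : Graph n m) where

  end₁ end₂ : Fin m → Fin n
  end₁ e = proj₁ (G e)
  end₂ e = proj₂ (G e)

  Joins : Fin m → Fin n → Fin n → Set
  Joins e u w = (end₁ e ≡ u × end₂ e ≡ w) ⊎ (end₁ e ≡ w × end₂ e ≡ u)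

  degree : EdgeSet m → Fin n → ℕ
  degree S v = sumOver S (λ e → endsAt G v e)

  deg≡degree : ∀ S v → deg G S v ≡ degree S v
  deg≡degree S v = sum-allFin (λ e → if S e then endsAt G v e else 0)

  endsIn : VertexSet n → Fin m → ℕ
  endsIn X e = 𝟙 (X (end₁ e)) + 𝟙 (X (end₂ e))

  endsIn≡ : ∀ X e {a b} → X (end₁ e) ≡ a → X (end₂ e) ≡ b → endsIn X e ≡ 𝟙 a + 𝟙 b
  endsIn≡ X e = cong₂ (λ a b → 𝟙 a + 𝟙 b)

  inside crossing : VertexSet n → EdgeSet m
  inside X e = X (end₁ e) ∧ X (end₂ e)
  crossing X e = X (end₁ e) xor X (end₂ e)

  verticesOf : EdgeSet m → VertexSet n
  verticesOf S v = does (1 ≤? degree S v)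

  sumOver-endsAt : ∀ X e → sumOver X (λ v → endsAt G v e) ≡ endsIn X e
  sumOver-endsAt X e = begin
    sum (λ v → if X v then endsAt G v e else 0)
      ≡⟨ sum-cong-≗ {n} split ⟩
    sum (λ v → at (end₁ e) v + at (end₂ e) v)
      ≡⟨ ∑-distrib-+ (at (end₁ e)) (at (end₂ e)) ⟩
    sumOver (λ v → does (end₁ e ≟ v)) (𝟙 ∘ X) + sumOver (λ v → does (end₂ e ≟ v)) (𝟙 ∘ X)
      ≡⟨ cong₂ _+_ (sum-singleton (end₁ e) (𝟙 ∘ X)) (sum-singleton (end₂ e) (𝟙 ∘ X)) ⟩
    endsIn X e ∎
    where
    open ≡-Reasoning
    at : Fin n → Fin n → ℕ
    at u v = if does (u ≟ v) then 𝟙 (X v) else 0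
    split : ∀ v → (if X v then endsAt G v e else 0) ≡ at (end₁ e) v + at (end₂ e) v
    split v with X v | does (end₁ e ≟ v) | does (end₂ e ≟ v)
    ... | true | b₁ | b₂ = refl
    ... | false | true | true = refl
    ... | false | true | false = refl
    ... | false | false | true = refl
    ... | false | false | false = refl

  handshake : ∀ X S → sumOver X (degree S) ≡ sumOver S (endsIn X)
  handshake X S = trans (sumOver-comm X S (λ v e → endsAt G v e))
                        (sum-cong-≗ {m} (λ e → cong (if S e then_else 0) (sumOver-endsAt X e)))

  degree-split : ∀ S T v → degree S v ≡ degree (S ∩E T) v + degree (S ∖E T) v
  degree-split S T v = sumOver-split S T (λ e → endsAt G v e)

  size-split : ∀ (S T : EdgeSet m) → ∣ S ∣ ≡ ∣ S ∩E T ∣ + ∣ S ∖E T ∣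
  size-split S T = sumOver-split S T (λ _ → 1)

  degree-mono : ∀ {S T} → S ⊆E T → ∀ v → degree S v ≤ degree T v
  degree-mono S⊆T v = sumOver-mono S⊆T (λ e → endsAt G v e)

  degree-cong : ∀ {S T} → S ≗ T → ∀ v → degree S v ≡ degree T v
  degree-cong S≗T v = sumOver-cong S≗T (λ e → endsAt G v e)

  endsAt≤degree : ∀ {S e} → S e ≡ true → ∀ v → endsAt G v e ≤ degree S v
  endsAt≤degree Se v = term≤sumOver Se (λ e → endsAt G v e)

  0<endsAt-end₁ : ∀ e → 0 < endsAt G (end₁ e) e
  0<endsAt-end₁ e rewrite dec-true (end₁ e ≟ end₁ e) refl = s≤s z≤n

  0<endsAt-end₂ : ∀ e → 0 < endsAt G (end₂ e) e
  0<endsAt-end₂ e rewrite dec-true (end₂ e ≟ end₂ e) refl =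
    subst (0 <_) (+-comm 1 (𝟙 (does (end₁ e ≟ end₂ e)))) (s≤s z≤n)

  0<endsAt-joined : ∀ {e u w} → Joins e u w → 0 < endsAt G u e × 0 < endsAt G w e
  0<endsAt-joined {e} (inj₁ (refl , refl)) = 0<endsAt-end₁ e , 0<endsAt-end₂ e
  0<endsAt-joined {e} (inj₂ (refl , refl)) = 0<endsAt-end₂ e , 0<endsAt-end₁ e

  0<degree-at-end : ∀ {S e v} → S e ≡ true → 0 < endsAt G v e → 0 < degree S v
  0<degree-at-end Se 0<endsAt = ≤-trans 0<endsAt (endsAt≤degree Se _)

  ∈verticesOf : ∀ {S v} → verticesOf S v ≡ true → 0 < degree S v
  ∈verticesOf {S} {v} = dec-true⁻¹ (1 ≤? degree S v)

  ∉verticesOf : ∀ {S v} → verticesOf S v ≡ false → degree S v ≡ 0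
  ∉verticesOf {S} {v} v∉ = n≤0⇒n≡0 (≮⇒≥ (dec-false⁻¹ (1 ≤? degree S v) v∉))

  end∈verticesOf : ∀ {S e v} → S e ≡ true → 0 < endsAt G v e → verticesOf S v ≡ true
  end∈verticesOf {S} {v = v} Se 0<endsAt = dec-true (1 ≤? degree S v) (0<degree-at-end Se 0<endsAt)

  DegreesZeroOrTwo : EdgeSet m → Set
  DegreesZeroOrTwo S = ∀ v → degree S v ≡ 0 ⊎ degree S v ≡ 2

  degree-of-vertex : ∀ {S v} → DegreesZeroOrTwo S → verticesOf S v ≡ true → degree S v ≡ 2
  degree-of-vertex {S} {v} zeroOrTwo v∈ with zeroOrTwo v
  ... | inj₂ ≡2 = ≡2
  ... | inj₁ ≡0 = ⊥-elim (<⇒≱ (∈verticesOf v∈) (≤-reflexive ≡0))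

  ∣verticesOf∣ : ∀ {S} → DegreesZeroOrTwo S → ∣ verticesOf S ∣ ≡ ∣ S ∣
  ∣verticesOf∣ {S} zeroOrTwo = *-cancelˡ-≡ _ _ 2 (begin
    2 * ∣ V ∣                       ≡⟨ sum-double (𝟙 ∘ V) ⟨
    sum (λ v → 2 * 𝟙 (V v))         ≡⟨ sum-cong-≗ {n} vertex-term ⟩
    sumOver V (degree S)            ≡⟨ handshake V S ⟩
    sumOver S (endsIn V)            ≡⟨ sum-cong-≗ {m} edge-term ⟩
    sum (λ e → 2 * 𝟙 (S e))         ≡⟨ sum-double (𝟙 ∘ S) ⟩
    2 * ∣ S ∣                       ∎)
    where
    open ≡-Reasoning
    V = verticesOf S
    vertex-term : ∀ v → 2 * 𝟙 (V v) ≡ (if V v then degree S v else 0)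
    vertex-term v with V v in v∈
    ... | true = sym (degree-of-vertex zeroOrTwo v∈)
    ... | false = refl
    edge-term : ∀ e → (if S e then endsIn V e else 0) ≡ 2 * 𝟙 (S e)
    edge-term e with S e in Se
    ... | true = endsIn≡ V e (end∈verticesOf Se (0<endsAt-end₁ e)) (end∈verticesOf Se (0<endsAt-end₂ e))
    ... | false = refl

  -- Count the ends in X of a perfect matching M: an edge inside X has two, a crossing edge one.
  matching-cut : ∀ {M} → (∀ v → degree M v ≡ 1) →
                 ∀ X → ∣ X ∣ ≡ 2 * ∣ M ∩E inside X ∣ + ∣ M ∩E crossing X ∣
  matching-cut {M} perfect X = begin
    ∣ X ∣                 ≡⟨ sum-cong-≗ {n} vertex-term ⟩
    sumOver X (degree M)  ≡⟨ handshake X M ⟩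
    sumOver M (endsIn X)  ≡⟨ sum-cong-≗ {m} edge-term ⟩
    sum (λ e → 2 * 𝟙 ((M ∩E inside X) e) + 𝟙 ((M ∩E crossing X) e))
      ≡⟨ ∑-distrib-+ (λ e → 2 * 𝟙 ((M ∩E inside X) e)) _ ⟩
    sum (λ e → 2 * 𝟙 ((M ∩E inside X) e)) + ∣ M ∩E crossing X ∣
      ≡⟨ cong (_+ ∣ M ∩E crossing X ∣) (sum-double (𝟙 ∘ (M ∩E inside X))) ⟩
    2 * ∣ M ∩E inside X ∣ + ∣ M ∩E crossing X ∣ ∎
    where
    open ≡-Reasoning
    vertex-term : ∀ v → 𝟙 (X v) ≡ (if X v then degree M v else 0)
    vertex-term v with X v
    ... | true = sym (perfect v)
    ... | false = refl
    edge-term : ∀ e → (if M e then endsIn X e else 0) ≡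
                      2 * 𝟙 ((M ∩E inside X) e) + 𝟙 ((M ∩E crossing X) e)
    edge-term e with M e | X (end₁ e) | X (end₂ e)
    ... | false | _ | _ = refl
    ... | true | true | true = refl
    ... | true | true | false = refl
    ... | true | false | true = refl
    ... | true | false | false = refl

  edge-of-saturated-vertex : ∀ {C D x g} → degree (C ∖E D) x ≡ 0 → C g ≡ true → 0 < endsAt G x g → D g ≡ true
  edge-of-saturated-vertex {C} {D} {x} {g} ≡0 Cg 0<endsAt with D g in Dg
  ... | true = refl
  ... | false = ⊥-elim (<⇒≱ 0<endsAt (≤-trans (endsAt≤degree C∖Dg x) (≤-reflexive ≡0)))
    where
    C∖Dg : (C ∖E D) g ≡ true
    C∖Dg = cong₂ (λ a b → a ∧ not b) Cg Dg

  connected-saturated-cover : ∀ {C D e} → IsCircuit G C →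
    (∀ v → 0 < degree (C ∩E D) v → degree (C ∖E D) v ≡ 0) → (C ∩E D) e ≡ true → C ⊆E D
  connected-saturated-cover {C} {D} {e} (_ , _ , connected) saturated C∩De g Cg =
    edge-of-saturated-vertex {C} {D} (saturated (end₁ g) (spread path 0<degree-end₁-e)) Cg (0<endsAt-end₁ g)
    where
    Ce = ∧-conicalˡ (C e) (D e) C∩De
    0<degree-end₁-e = 0<degree-at-end C∩De (0<endsAt-end₁ e)
    positive : ∀ {v h} → C h ≡ true → 0 < endsAt G v h → 0 < deg G C v
    positive Ch 0<endsAt = subst (0 <_) (sym (deg≡degree C _)) (0<degree-at-end Ch 0<endsAt)
    path = connected (end₁ e) (end₁ g) (positive Ce (0<endsAt-end₁ e)) (positive Cg (0<endsAt-end₁ g))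
    spread : ∀ {x y} → Reach G C x y → 0 < degree (C ∩E D) x → 0 < degree (C ∩E D) y
    spread here 0<deg = 0<deg
    spread (step h Ch joins rest) 0<deg = spread rest (0<degree-at-end C∩Dh (proj₂ (0<endsAt-joined joins)))
      where
      C∩Dh : (C ∩E D) h ≡ true
      C∩Dh = cong₂ _∧_ Ch (edge-of-saturated-vertex {C} {D} (saturated _ 0<deg) Ch (proj₁ (0<endsAt-joined joins)))

  circuit-degrees : ∀ {C} → IsCircuit G C → DegreesZeroOrTwo C
  circuit-degrees {C} (_ , zeroOrTwo , _) v rewrite sym (deg≡degree C v) = zeroOrTwo v

  two-edges≤degree : ∀ {S e g} → S e ≡ true → S g ≡ true → e ≢ g →
                     ∀ v → endsAt G v e + endsAt G v g ≤ degree S v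
  two-edges≤degree {S} {e} {g} Se Sg e≢g v =
    subst (_≤ degree S v) (cong₂ _+_ (term Se) (term Sg)) (two-terms≤sum (λ h → if S h then endsAt G v h else 0) e≢g)
    where
    term : ∀ {h} → S h ≡ true → (if S h then endsAt G v h else 0) ≡ endsAt G v h
    term Sh = cong (if_then endsAt G v _ else 0) Sh

  endsAt-loop : ∀ e → end₁ e ≡ end₂ e → endsAt G (end₁ e) e ≡ 2
  endsAt-loop e loop rewrite sym loop | dec-true (end₁ e ≟ end₁ e) refl = refl

  endsAt≡0 : ∀ {v e} → endsAt G v e ≡ 0 → end₁ e ≢ v × end₂ e ≢ v
  endsAt≡0 {v} {e} ≡0 with end₁ e ≟ v | end₂ e ≟ v
  ... | no ≢₁ | no ≢₂ = ≢₁ , ≢₂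
  ... | yes _ | _ = ⊥-elim (0≢1+n (sym ≡0))
  ... | no _ | yes _ = ⊥-elim (0≢1+n (sym ≡0))

  two-edges-at : ∀ {S v} → (∀ e → endsAt G v e ≤ 1) → 2 ≤ degree S v →
                 ∃ λ e → ∃ λ f → e ≢ f × S e ≡ true × S f ≡ true × 0 < endsAt G v e × 0 < endsAt G v f
  two-edges-at {S} {v} endsAt≤1 2≤degree
    with e , f , e≢f , term-e , term-f ←
           two-unit-terms (λ e → if S e then endsAt G v e else 0) (λ e → if-then-0-≤ (S e) (endsAt≤1 e)) 2≤degree
    with Se , at-e ← if-then-0-≡1 term-e
    with Sf , at-f ← if-then-0-≡1 term-f
    = e , f , e≢f , Se , Sf , at-e , at-f

-- Cubic graphs with a 2-factor whose contraction is 5-odd-edge-connected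

module TwoFactorOfCubic {n m : ℕ} (G : Graph n m) (cubic : Cubic G) (F : EdgeSet m) (twoFactor : IsTwoFactor G F)
                        (oddConnected : ContractionFiveOddEdgeConnected G F) where
  open Degrees G

  F̄ : EdgeSet m
  F̄ e = not (F e)

  degree-F̄ : ∀ v → degree F̄ v ≡ 1
  degree-F̄ v = +-cancelˡ-≡ 2 _ _ (begin
    2 + degree F̄ v                ≡⟨ cong (_+ degree F̄ v) (trans (sym (twoFactor v)) (deg≡degree F v)) ⟩
    degree F v + degree F̄ v       ≡⟨ degree-split allEdges F v ⟨
    degree allEdges v             ≡⟨ trans (sym (deg≡degree allEdges v)) (cubic v) ⟩
    3                             ∎)
    where open ≡-Reasoning

  cut-identity : ∀ X → ∣ X ∣ ≡ 2 * ∣ F̄ ∩E inside X ∣ + cutContr G F X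
  cut-identity X =
    trans (matching-cut degree-F̄ X) (cong (2 * ∣ F̄ ∩E inside X ∣ +_) (sym (count≡∣∣ (F̄ ∩E crossing X))))

  singleton : Fin n → VertexSet n
  singleton v u = does (v ≟ u)

  singleton-not-closed : ∀ v → ¬ FClosed G F (singleton v)
  singleton-not-closed v closed = proj₁ (oddConnected (singleton v) closed)
    (2*k+c≡1⇒c≡1 ∣ F̄ ∩E inside (singleton v) ∣ (cutContr G F (singleton v))
      (trans (sym (cut-identity (singleton v))) (sum-singleton v (λ _ → 1))))

  F-loop-singleton-closed : ∀ {e} → F e ≡ true → end₁ e ≡ end₂ e → FClosed G F (singleton (end₁ e))
  F-loop-singleton-closed {e} Fe loop g Fg with g ≟ e
  ... | yes refl = cong (singleton (end₁ e)) loop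
  ... | no g≢e =
    trans (dec-false (v ≟ end₁ g) (proj₁ avoids ∘ sym)) (sym (dec-false (v ≟ end₂ g) (proj₂ avoids ∘ sym)))
    where
    v = end₁ e
    endsAt-g≡0 : endsAt G v g ≡ 0
    endsAt-g≡0 = n≤0⇒n≡0 (+-cancelˡ-≤ 2 _ 0 (begin
      2 + endsAt G v g                ≡⟨ cong (_+ endsAt G v g) (endsAt-loop e loop) ⟨
      endsAt G v e + endsAt G v g     ≤⟨ two-edges≤degree Fe Fg (g≢e ∘ sym) v ⟩
      degree F v                      ≡⟨ trans (sym (deg≡degree F v)) (twoFactor v) ⟩
      2                               ∎))
      where open ℕ.≤-Reasoning
    avoids = endsAt≡0 endsAt-g≡0

  -- A loop in F would be a whole circuit of F with one edge leaving it; a loop outside F would give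
  -- its vertex two ends of edges outside F.
  loopless : ∀ e → end₁ e ≢ end₂ e
  loopless e loop with F e in Fe
  ... | true = singleton-not-closed (end₁ e) (F-loop-singleton-closed Fe loop)
  ... | false = <⇒≱ (n<1+n 1) (begin
    2                     ≡⟨ endsAt-loop e loop ⟨
    endsAt G (end₁ e) e   ≤⟨ endsAt≤degree (cong not Fe) (end₁ e) ⟩
    degree F̄ (end₁ e)     ≡⟨ degree-F̄ (end₁ e) ⟩
    1                     ∎)
    where open ℕ.≤-Reasoning

  endsAt≤1 : ∀ v e → endsAt G v e ≤ 1
  endsAt≤1 v e with end₁ e ≟ v | end₂ e ≟ v
  ... | yes ≡₁ | yes ≡₂ = ⊥-elim (loopless e (trans ≡₁ (sym ≡₂)))
  ... | yes _ | no _ = ≤-refl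
  ... | no _ | yes _ = ≤-refl
  ... | no _ | no _ = z≤n

  module FiveCircuitOfF (C : EdgeSet m) (circuitOf : CircuitOf G F C) (size5 : size C ≡ 5) where

    V : VertexSet n
    V = verticesOf C

    C-degrees : DegreesZeroOrTwo C
    C-degrees = circuit-degrees (proj₁ circuitOf)

    ∣C∣≡5 : ∣ C ∣ ≡ 5
    ∣C∣≡5 = trans (sym (count≡∣∣ C)) size5

    F-edge-off-C-avoids : ∀ {e v} → F e ≡ true → C e ≡ false → 0 < endsAt G v e → V v ≡ false
    F-edge-off-C-avoids {e} {v} Fe Ce 0<endsAt =
      cong (λ d → does (1 ≤? d)) (trans (sym (deg≡degree C v)) (proj₂ (proj₂ circuitOf) e Fe Ce v 0<endsAt))

    V-closed : FClosed G F V
    V-closed e Fe with C e in Ce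
    ... | true = trans (end∈verticesOf Ce (0<endsAt-end₁ e)) (sym (end∈verticesOf Ce (0<endsAt-end₂ e)))
    ... | false = trans (F-edge-off-C-avoids Fe Ce (0<endsAt-end₁ e)) (sym (F-edge-off-C-avoids Fe Ce (0<endsAt-end₂ e)))

    chordless : ∀ e → (F̄ ∩E inside V) e ≡ false
    chordless = ∣∣≡0⇒empty (2*k+c≡5⇒k≡0 ∣ F̄ ∩E inside V ∣ (cutContr G F V)
      (trans (sym (cut-identity V)) (trans (∣verticesOf∣ C-degrees) ∣C∣≡5))
      (proj₁ (oddConnected V V-closed)) (proj₂ (oddConnected V V-closed)))

    degree-off-C≤1 : ∀ S {v} → V v ≡ true → degree (S ∖E C) v ≤ 1
    degree-off-C≤1 S {v} v∈V = ≤-trans (sum-mono-≤ pointwise) (≤-reflexive (degree-F̄ v))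
      where
      pointwise : ∀ e → (if (S ∖E C) e then endsAt G v e else 0) ≤ (if F̄ e then endsAt G v e else 0)
      pointwise e with (S ∖E C) e in S∖Ce | F e in Fe | endsAt G v e in endsAt≡
      ... | false | _ | _ = z≤n
      ... | true | false | _ = ≤-refl
      ... | true | true | zero = z≤n
      ... | true | true | suc _ with () ← trans (sym v∈V)
              (F-edge-off-C-avoids Fe (∖E⇒∉ {S = S} {C} S∖Ce) (subst (0 <_) (sym endsAt≡) (s≤s z≤n)))

    F-edge-off-C-misses-V : ∀ {e} → F e ≡ true → C e ≡ false → endsIn V e ≡ 0
    F-edge-off-C-misses-V {e} Fe Ce =
      endsIn≡ V e (F-edge-off-C-avoids Fe Ce (0<endsAt-end₁ e)) (F-edge-off-C-avoids Fe Ce (0<endsAt-end₂ e))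

    edge-off-C-meets-V-once : ∀ {e} → C e ≡ false → endsIn V e ≤ 1
    edge-off-C-meets-V-once {e} Ce with F e in Fe
    ... | true = ≤-trans (≤-reflexive (F-edge-off-C-misses-V Fe Ce)) z≤n
    ... | false = not-both (V (end₁ e)) (V (end₂ e)) (trans (cong (λ b → not b ∧ inside V e) (sym Fe)) (chordless e))
      where
      not-both : ∀ a b → a ∧ b ≡ false → 𝟙 a + 𝟙 b ≤ 1
      not-both true true ()
      not-both true false _ = ≤-refl
      not-both false true _ = ≤-refl
      not-both false false _ = z≤n

    module IntersectionWith (D : EdgeSet m) (D-degrees : DegreesZeroOrTwo D) (∣D∣≡5 : ∣ D ∣ ≡ 5)
                              (C≠D : Different C D) {e₀ : Fin m} (e₀∈C∩D : (C ∩E D) e₀ ≡ true) where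

      I O : EdgeSet m
      I = C ∩E D
      O = D ∖E C

      shared : VertexSet n
      shared v = V v ∧ does (degree I v ℕ.≟ 2)

      B : ℕ
      B = sumOver V (degree O)

      I⊆C : I ⊆E C
      I⊆C e = ∧-conicalˡ (C e) (D e)

      ∣I∣+∣O∣≡5 : ∣ I ∣ + ∣ O ∣ ≡ 5
      ∣I∣+∣O∣≡5 = begin
        ∣ C ∩E D ∣ + ∣ O ∣   ≡⟨ cong (_+ ∣ O ∣) (sum-cong-≗ {m} (λ e → cong 𝟙 (∧-comm (C e) (D e)))) ⟩
        ∣ D ∩E C ∣ + ∣ O ∣   ≡⟨ size-split D C ⟨
        ∣ D ∣                ≡⟨ ∣D∣≡5 ⟩
        5                    ∎
        where open ≡-Reasoning

      degree-D : ∀ v → degree D v ≡ degree I v + degree O v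
      degree-D v = trans (degree-split D C v) (cong (_+ degree O v) (degree-cong (λ e → ∧-comm (D e) (C e)) v))

      -- At a vertex of C at most one edge of O is present (the non-F edge), and D has degree 0 or 2.
      degree-I-at-V : ∀ v → (if V v then degree I v else 0) ≡ (if V v then degree O v else 0) + 2 * 𝟙 (shared v)
      degree-I-at-V v with V v in v∈V
      ... | false = refl
      ... | true = even-split (degree I v) (degree O v)
                     (≤-trans (degree-mono I⊆C v) (≤-reflexive (degree-of-vertex C-degrees v∈V)))
                     (degree-off-C≤1 D v∈V)
                     (Data.Sum.map (trans (sym (degree-D v))) (trans (sym (degree-D v))) (D-degrees v))

      2∣I∣≡B+2∣shared∣ : 2 * ∣ I ∣ ≡ B + 2 * ∣ shared ∣
      2∣I∣≡B+2∣shared∣ = begin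
        2 * ∣ I ∣                                   ≡⟨ sum-double (𝟙 ∘ I) ⟨
        sum (λ e → 2 * 𝟙 (I e))                     ≡⟨ sum-cong-≗ {m} edge-term ⟩
        sumOver I (endsIn V)                        ≡⟨ handshake V I ⟨
        sumOver V (degree I)                        ≡⟨ sum-cong-≗ {n} degree-I-at-V ⟩
        sum (λ v → (if V v then degree O v else 0) + 2 * 𝟙 (shared v))
          ≡⟨ ∑-distrib-+ (λ v → if V v then degree O v else 0) _ ⟩
        B + sum (λ v → 2 * 𝟙 (shared v))              ≡⟨ cong (B +_) (sum-double (𝟙 ∘ shared)) ⟩
        B + 2 * ∣ shared ∣                            ∎
        where
        open ≡-Reasoning
        edge-term : ∀ e → 2 * 𝟙 (I e) ≡ (if I e then endsIn V e else 0)
        edge-term e with I e in Ie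
        ... | false = refl
        ... | true = sym (endsIn≡ V e (end∈verticesOf (I⊆C e Ie) (0<endsAt-end₁ e))
                                      (end∈verticesOf (I⊆C e Ie) (0<endsAt-end₂ e)))

      O-ends-in-V : ∀ e → (if O e then endsIn V e else 0) ≤ 𝟙 (O e)
      O-ends-in-V e with O e in Oe
      ... | false = z≤n
      ... | true = edge-off-C-meets-V-once (∖E⇒∉ {S = D} {C} Oe)

      B≤∣O∣ : B ≤ ∣ O ∣
      B≤∣O∣ = ≤-trans (≤-reflexive (handshake V O)) (sum-mono-≤ O-ends-in-V)

      saturated-if-B≡0 : B ≡ 0 → ∀ v → 0 < degree I v → degree (C ∖E D) v ≡ 0
      saturated-if-B≡0 B≡0 v 0<degree-I = +-cancelˡ-≡ 2 _ 0 (begin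
        2 + degree (C ∖E D) v             ≡⟨ cong (_+ degree (C ∖E D) v) degree-I≡2 ⟨
        degree I v + degree (C ∖E D) v    ≡⟨ degree-split C D v ⟨
        degree C v                        ≡⟨ degree-of-vertex C-degrees v∈V ⟩
        2                                 ∎)
        where
        open ≡-Reasoning
        v∈V : V v ≡ true
        v∈V = dec-true (1 ≤? degree C v) (≤-trans 0<degree-I (degree-mono I⊆C v))
        degree-O≡0 : degree O v ≡ 0
        degree-O≡0 = n≤0⇒n≡0 (≤-trans (term≤sumOver v∈V (degree O)) (≤-reflexive B≡0))
        degree-D≡degree-I : degree D v ≡ degree I v
        degree-D≡degree-I = trans (degree-D v) (trans (cong (degree I v +_) degree-O≡0) (+-identityʳ _))
        degree-I≡2 : degree I v ≡ 2
        degree-I≡2 with D-degrees v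
        ... | inj₂ ≡2 = trans (sym degree-D≡degree-I) ≡2
        ... | inj₁ ≡0 = ⊥-elim (<⇒≱ 0<degree-I (≤-reflexive (trans (sym degree-D≡degree-I) ≡0)))

      B-positive : 0 < B
      B-positive with B in B≡
      ... | suc _ = s≤s z≤n
      ... | zero = ⊥-elim (C≠D (⊆-∣∣-≡⇒≗ C⊆D (trans ∣C∣≡5 (sym ∣D∣≡5))))
        where
        C⊆D : C ⊆E D
        C⊆D = connected-saturated-cover (proj₁ circuitOf) (saturated-if-B≡0 B≡) e₀∈C∩D

      O-edges-cross-V : B ≡ ∣ O ∣ → ∀ {e} → O e ≡ true → endsIn V e ≡ 1
      O-edges-cross-V B≡∣O∣ {e} Oe =
        trans (cong (if_then endsIn V e else 0) (sym Oe)) (trans (once e) (cong 𝟙 Oe))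
        where
        once : ∀ e → (if O e then endsIn V e else 0) ≡ 𝟙 (O e)
        once = pointwise-≤-sum-≡ O-ends-in-V (trans (sym (handshake V O)) B≡∣O∣)

      crossing-O-edge-not-in-F : ∀ {e} → O e ≡ true → endsIn V e ≡ 1 → F e ≡ false
      crossing-O-edge-not-in-F {e} Oe crosses with F e in Fe
      ... | false = refl
      ... | true with () ← trans (sym (F-edge-off-C-misses-V Fe (∖E⇒∉ {S = D} {C} Oe))) crosses

      ¬all-O-edges-cross-V : ∀ {x} → O x ≡ true → ¬ (∀ {e} → O e ≡ true → endsIn V e ≡ 1)
      ¬all-O-edges-cross-V {x} Ox all-cross = <⇒≱ (n<1+n 1) (begin
        2                               ≡⟨ degree-D≡2 ⟨
        degree D w                      ≡⟨ degree-D w ⟩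
        degree I w + degree O w         ≡⟨ cong (_+ degree O w) degree-I≡0 ⟩
        degree O w                      ≤⟨ degree-mono (λ e Oe → cong not (crossing-O-edge-not-in-F Oe (all-cross Oe))) w ⟩
        degree F̄ w                      ≡⟨ degree-F̄ w ⟩
        1                               ∎)
        where
        open ℕ.≤-Reasoning
        outer-end : ∃ λ w → V w ≡ false × 0 < endsAt G w x
        outer-end with V (end₁ x) in V₁ | V (end₂ x) in V₂
        ... | false | _ = end₁ x , V₁ , 0<endsAt-end₁ x
        ... | true | false = end₂ x , V₂ , 0<endsAt-end₂ x
        ... | true | true with () ← trans (sym (all-cross Ox)) (endsIn≡ V x V₁ V₂)
        w = proj₁ outer-end
        degree-I≡0 : degree I w ≡ 0
        degree-I≡0 = n≤0⇒n≡0 (≤-trans (degree-mono I⊆C w) (≤-reflexive (∉verticesOf (proj₁ (proj₂ outer-end)))))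
        degree-D≡2 : degree D w ≡ 2
        degree-D≡2 with D-degrees w
        ... | inj₂ ≡2 = ≡2
        ... | inj₁ ≡0 =
          ⊥-elim (<⇒≱ (0<degree-at-end (∧-conicalˡ (D x) _ Ox) (proj₂ (proj₂ outer-end))) (≤-reflexive ≡0))

      B≢∣O∣ : B ≡ ∣ O ∣ → 0 < ∣ O ∣ → ⊥
      B≢∣O∣ B≡∣O∣ 0<∣O∣ with x , 0<𝟙-Ox ← sum-positive (𝟙 ∘ O) 0<∣O∣ =
        ¬all-O-edges-cross-V (𝟙-positive 0<𝟙-Ox) (O-edges-cross-V B≡∣O∣)

      adjacent-pair : 0 < ∣ shared ∣ →
        ∃ λ e → ∃ λ f → e ≢ f × I e ≡ true × I f ≡ true × ∃ λ v → 0 < endsAt G v e × 0 < endsAt G v f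
      adjacent-pair 0<∣shared∣
        with v , 0<𝟙-shared-v ← sum-positive (𝟙 ∘ shared) 0<∣shared∣
        with e , f , e≢f , Ie , If , at-e , at-f ←
               two-edges-at (endsAt≤1 v)
                 (≤-reflexive (sym (dec-true⁻¹ (degree I v ℕ.≟ 2) (∧-conicalʳ (V v) _ (𝟙-positive 0<𝟙-shared-v)))))
        = e , f , e≢f , Ie , If , v , at-e , at-f

      small-intersection : size (C ∩E D) ≡ 1 ⊎ TwoAdjacent G (C ∩E D)
      small-intersection
        with intersection-arith (∣ I ∣) (∣ O ∣) B (∣ shared ∣) 2∣I∣≡B+2∣shared∣ B≤∣O∣ ∣I∣+∣O∣≡5 B-positive
      ... | inj₁ ∣I∣≡1 = inj₁ (trans (count≡∣∣ I) ∣I∣≡1)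
      ... | inj₂ (inj₁ (∣I∣≡2 , 0<∣shared∣)) = inj₂ (trans (count≡∣∣ I) ∣I∣≡2 , adjacent-pair 0<∣shared∣)
      ... | inj₂ (inj₂ (B≡∣O∣ , 0<∣O∣)) = ⊥-elim (B≢∣O∣ B≡∣O∣ 0<∣O∣)

-- Deciding reachability and the existence of edge sets

module Saturation {n : ℕ} (expand : VertexSet n → VertexSet n) (extensive : ∀ X → X ⊆E expand X)
                  (expand-cong : ∀ {X Y} → X ≗ Y → expand X ≗ expand Y) where

  iterates : VertexSet n → ℕ → VertexSet n
  iterates X k = fold X expand k

  Stable : VertexSet n → Set
  Stable X = expand X ≗ X

  iterates-extensive : ∀ X k → X ⊆E iterates X k
  iterates-extensive X zero u Xu = Xu
  iterates-extensive X (suc k) u Xu = extensive (iterates X k) u (iterates-extensive X k u Xu)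

  stable? : ∀ X → Dec (Stable X)
  stable? X = Fin.all? (λ u → expand X u Bool.≟ X u)

  grows : ∀ X → ¬ Stable X → ∣ X ∣ < ∣ expand X ∣
  grows X unstable with u , changed ← Fin.¬∀⟶∃¬ n _ (λ u → expand X u Bool.≟ X u) unstable =
    sum-mono-< (λ v → 𝟙-mono (extensive X v)) (strict (X u) (expand X u) (extensive X u) changed)
    where
    strict : ∀ a b → (a ≡ true → b ≡ true) → b ≢ a → 𝟙 a < 𝟙 b
    strict true _ a⇒b b≢a = ⊥-elim (b≢a (a⇒b refl))
    strict false true _ _ = s≤s z≤n
    strict false false _ b≢a = ⊥-elim (b≢a refl)

  progress : ∀ X k → Stable (iterates X k) ⊎ k < ∣ iterates X (suc k) ∣
  progress X zero with stable? X
  ... | yes stable = inj₁ stable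
  ... | no unstable = inj₂ (≤-trans (s≤s z≤n) (grows X unstable))
  progress X (suc k) with progress X k
  ... | inj₁ stable = inj₁ (expand-cong stable)
  ... | inj₂ k<∣Xₖ₊₁∣ with stable? (iterates X (suc k))
  ...   | yes stable = inj₁ stable
  ...   | no unstable = inj₂ (≤-trans (s≤s k<∣Xₖ₊₁∣) (grows _ unstable))

  -- Until they stabilise the iterates grow strictly, and a subset of Fin n has at most n elements.
  iterates-stable : ∀ X → Stable (iterates X n)
  iterates-stable X with progress X n
  ... | inj₁ stable = stable
  ... | inj₂ n<∣Xₙ₊₁∣ = ⊥-elim (<⇒≱ n<∣Xₙ₊₁∣ (∣p∣≤k (iterates X (suc n))))

module ReachabilityDecision {n m : ℕ} (G : Graph n m) (S : EdgeSet m) (target : Fin n) where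
  open Degrees G using (Joins; end₁; end₂)

  joins? : ∀ e u w → Dec (Joins e u w)
  joins? e u w = ((end₁ e ≟ u) ×-dec (end₂ e ≟ w)) ⊎-dec ((end₁ e ≟ w) ×-dec (end₂ e ≟ u))

  StepsInto : VertexSet n → Fin n → Set
  StepsInto X u = ∃ λ e → S e ≡ true × ∃ λ w → Joins e u w × X w ≡ true

  stepsInto? : ∀ X u → Dec (StepsInto X u)
  stepsInto? X u = Fin.any? λ e → (S e Bool.≟ true) ×-dec Fin.any? λ w → joins? e u w ×-dec (X w Bool.≟ true)

  expand : VertexSet n → VertexSet n
  expand X u = X u ∨ does (stepsInto? X u)

  extensive : ∀ X → X ⊆E expand X
  extensive X u Xu rewrite Xu = refl

  expand-cong : ∀ {X Y} → X ≗ Y → expand X ≗ expand Y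
  expand-cong {X} {Y} X≗Y u =
    cong₂ _∨_ (X≗Y u) (does-⇔ (mk⇔ (transport X≗Y) (transport (sym ∘ X≗Y))) (stepsInto? X u) (stepsInto? Y u))
    where
    transport : ∀ {X Y} → X ≗ Y → StepsInto X u → StepsInto Y u
    transport X≗Y (e , Se , w , joins , Xw) = e , Se , w , joins , trans (sym (X≗Y w)) Xw

  open Saturation expand extensive expand-cong

  reaching : VertexSet n
  reaching = iterates (λ u → does (u ≟ target)) n

  sound : ∀ k u → iterates (λ u → does (u ≟ target)) k u ≡ true → Reach G S u target
  sound zero u u≡target with dec-true⁻¹ (u ≟ target) u≡target
  ... | refl = here
  sound (suc k) u u∈ with ∨-true _ _ u∈
  ... | inj₁ u∈ₖ = sound k u u∈ₖ
  ... | inj₂ steps with e , Se , w , joins , w∈ₖ ← dec-true⁻¹ (stepsInto? _ u) steps =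
    step e Se joins (sound k w w∈ₖ)

  complete : ∀ {u} → Reach G S u target → reaching u ≡ true
  complete here = iterates-extensive _ n target (dec-true (target ≟ target) refl)
  complete {u} (step e Se joins rest) =
    trans (sym (iterates-stable _ u))
          (trans (cong (reaching u ∨_) (dec-true (stepsInto? reaching u) (e , Se , _ , joins , complete rest)))
                 (Bool.∨-zeroʳ (reaching u)))

  reach? : ∀ u → Dec (Reach G S u target)
  reach? u with reaching u in u∈
  ... | true = yes (sound n u u∈)
  ... | false = no (λ path → case trans (sym (complete path)) u∈ of λ ())

any-edge-set? : ∀ {m} {P : EdgeSet m → Set} → (∀ {S T} → S ≗ T → P S → P T) → (∀ S → Dec (P S)) → Dec (∃ P)
any-edge-set? resp P? =
  map′ (λ (s , Ps) → Vec.lookup s , Ps) (λ (S , PS) → Vec.tabulate S , resp (sym ∘ Vec.lookup∘tabulate S) PS)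
       (anySubset? (P? ∘ Vec.lookup))

module EdgeSetInvariance {n m : ℕ} (G : Graph n m) {S T : EdgeSet m} (S≗T : S ≗ T) where
  open Degrees G

  deg-cong : ∀ v → deg G S v ≡ deg G T v
  deg-cong v = trans (deg≡degree S v) (trans (degree-cong S≗T v) (sym (deg≡degree T v)))

  reach-cong : ∀ {u v} → Reach G S u v → Reach G T u v
  reach-cong here = here
  reach-cong (step e Se joins rest) = step e (trans (sym (S≗T e)) Se) joins (reach-cong rest)

  five-circuit-cong : FiveCircuit G S → FiveCircuit G T
  five-circuit-cong (((e , Se) , zeroOrTwo , connected) , size5) =
    ((e , trans (sym (S≗T e)) Se) ,
     (λ v → Data.Sum.map (trans (sym (deg-cong v))) (trans (sym (deg-cong v))) (zeroOrTwo v)) ,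
     (λ u v 0<u 0<v → reach-cong (connected u v (subst (0 <_) (sym (deg-cong u)) 0<u)
                                                 (subst (0 <_) (sym (deg-cong v)) 0<v)))) ,
    trans (trans (count≡∣∣ T) (sum-cong-≗ {m} (λ e → cong 𝟙 (sym (S≗T e))))) (trans (sym (count≡∣∣ S)) size5)

MeetingFiveCircuit : ∀ {n m} → Graph n m → EdgeSet m → EdgeSet m → Set
MeetingFiveCircuit G C D = FiveCircuit G D × Different C D × ∃ λ e → (C ∩E D) e ≡ true

meeting-cong : ∀ {n m} (G : Graph n m) (C : EdgeSet m) {D D′ : EdgeSet m} → D ≗ D′ →
               MeetingFiveCircuit G C D → MeetingFiveCircuit G C D′
meeting-cong G C D≗D′ (D-five , C≠D , e , e∈C∩D) =
  EdgeSetInvariance.five-circuit-cong G D≗D′ D-five ,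
  (λ C≗D′ → C≠D (λ e → trans (C≗D′ e) (sym (D≗D′ e)))) ,
  e , trans (cong (C e ∧_) (sym (D≗D′ e))) e∈C∩D

circuit? : ∀ {n m} (G : Graph n m) S → Dec (IsCircuit G S)
circuit? G S =
  Fin.any? (λ e → S e Bool.≟ true) ×-dec
  Fin.all? (λ v → (deg G S v ℕ.≟ 0) ⊎-dec (deg G S v ℕ.≟ 2)) ×-dec
  Fin.all? (λ u → Fin.all? (λ v → (0 ℕ.<? deg G S u) →-dec (0 ℕ.<? deg G S v) →-dec ReachabilityDecision.reach? G S v u))

meeting? : ∀ {n m} (G : Graph n m) C D → Dec (MeetingFiveCircuit G C D)
meeting? G C D =
  (circuit? G D ×-dec (size D ℕ.≟ 5)) ×-dec
  ¬? (Fin.all? (λ e → C e Bool.≟ D e)) ×-dec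
  Fin.any? (λ e → (C ∩E D) e Bool.≟ true)

lemma10 : (n m : ℕ) (G : Graph n m) → Cubic G → Bridgeless G →
          (F : EdgeSet m) → IsTwoFactor G F → ContractionFiveOddEdgeConnected G F →
          (C : EdgeSet m) → CircuitOf G F C → size C ≡ 5 →
          InCI G C ⊎ InCN G C
lemma10 n m G cubic _ F twoFactor oddConnected C circuitOf size5
  with any-edge-set? (meeting-cong G C) (meeting? G C)
... | yes (D , D-five@(D-circuit , sizeD) , C≠D , _ , e₀∈C∩D) =
  inj₁ (C-five , D , D-five , C≠D , small-intersection)
  where
  C-five : FiveCircuit G C
  C-five = proj₁ circuitOf , size5
  open TwoFactorOfCubic G cubic F twoFactor oddConnected
  open FiveCircuitOfF C circuitOf size5
  open IntersectionWith D (Degrees.circuit-degrees G D-circuit) (trans (sym (count≡∣∣ D)) sizeD) C≠D e₀∈C∩D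
... | no no-meeting =
  inj₂ ((proj₁ circuitOf , size5) ,
        λ D D-five C≠D e → Bool.¬-not (λ e∈C∩D → no-meeting (D , D-five , C≠D , e , e∈C∩D)))
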